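{- For all integers $n\geqslant 1$ and $s\geqslant 0$, the $s$-jet graph $\mathcal{J}_s(K_{n,n})$ of the complete bipartite graph $K_{n,n}$ is very well covered.
   Context: For a simple graph $G$ with vertex set $\{x_1,\dots,x_m\}$ and $s\in\mathbb{N}$, the $s$-jet graph $\mathcal{J}_s(G)$ is the simple graph with vertex set $\{x_{i,j}\mid i=1,\dots,m,\ j=0,\dots,s\}$ in which $\{x_{i,j},x_{k,l}\}$ is an edge if and only if $\{x_i,x_k\}$ is an edge of $G$ and $j+l\leqslant s$. A graph is very well covered if every minimal vertex cover (a vertex set meeting every edge, minimal under inclusion) contains exactly half of the vertices of the graph. -}

module Defs where

open import Data.Nat using (ℕ; zero; suc; _+_; _*_; _≤_)
open import Data.Fin using (Fin; toℕ; remQuot; splitAt)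
open import Data.Fin.Subset using (Subset; _∈_; _⊆_; _⊂_; ∣_∣)
open import Data.Product using (_×_; _,_; proj₁; proj₂)
open import Data.Nat.Properties using (+-comm)
open import Data.Sum using (_⊎_; inj₁; inj₂)
open import Data.Empty using (⊥)
open import Data.Unit using (⊤)
open import Relation.Nullary using (¬_)
open import Relation.Binary.PropositionalEquality using (_≡_; subst)

record SimpleGraph (m : ℕ) : Set₁ where
  field
    Adj       : Fin m → Fin m → Set
    Adj-sym   : ∀ {x y} → Adj x y → Adj y x
    Adj-irrefl : ∀ {x} → ¬ Adj x x
open SimpleGraph public

IsVertexCover : ∀ {m} → SimpleGraph m → Subset m → Set
IsVertexCover G C = ∀ x y → Adj G x y → x ∈ C ⊎ y ∈ C

IsMinimalVertexCover : ∀ {m} → SimpleGraph m → Subset m → Set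
IsMinimalVertexCover G C =
  IsVertexCover G C × (∀ D → D ⊂ C → ¬ IsVertexCover G D)

VeryWellCovered : ∀ {m} → SimpleGraph m → Set
VeryWellCovered {m} G = ∀ C → IsMinimalVertexCover G C → 2 * ∣ C ∣ ≡ m

KAdj : ∀ {n} → Fin n ⊎ Fin n → Fin n ⊎ Fin n → Set
KAdj (inj₁ _) (inj₂ _) = ⊤
KAdj (inj₂ _) (inj₁ _) = ⊤
KAdj (inj₁ _) (inj₁ _) = ⊥
KAdj (inj₂ _) (inj₂ _) = ⊥

KAdj-sym : ∀ {n} {a b : Fin n ⊎ Fin n} → KAdj a b → KAdj b a
KAdj-sym {a = inj₁ _} {inj₂ _} p = p
KAdj-sym {a = inj₂ _} {inj₁ _} p = p

KAdj-irrefl : ∀ {n} {a : Fin n ⊎ Fin n} → ¬ KAdj a a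
KAdj-irrefl {a = inj₁ _} ()
KAdj-irrefl {a = inj₂ _} ()

completeBipartite : (n : ℕ) → SimpleGraph (n + n)
completeBipartite n = record
  { Adj        = λ x y → KAdj (splitAt n x) (splitAt n y)
  ; Adj-sym    = KAdj-sym
  ; Adj-irrefl = KAdj-irrefl
  }

-- The s-jet graph J_s(G): vertex x_{i,j} (i : Fin m, j ∈ {0..s}) is encoded
-- as the element of Fin (m * suc s) whose remQuot is (i , j).
-- {x_{i,j}, x_{k,l}} is an edge iff {x_i,x_k} is an edge of G and j + l ≤ s.
vtx : ∀ m s → Fin (m * suc s) → Fin m
vtx m s u = proj₁ (remQuot {m} (suc s) u)

lvl : ∀ m s → Fin (m * suc s) → ℕ
lvl m s u = toℕ (proj₂ (remQuot {m} (suc s) u))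

jetAdj : ∀ {m} → (s : ℕ) → SimpleGraph m → Fin (m * suc s) → Fin (m * suc s) → Set
jetAdj {m} s G u v = Adj G (vtx m s u) (vtx m s v) × (lvl m s u + lvl m s v ≤ s)

jetAdj-sym : ∀ {m} s (G : SimpleGraph m) {u v} → jetAdj s G u v → jetAdj s G v u
jetAdj-sym {m} s G {u} {v} (a , b) =
  Adj-sym G a , subst (_≤ s) (+-comm (lvl m s u) (lvl m s v)) b

jetGraph : ∀ {m} → (s : ℕ) → SimpleGraph m → SimpleGraph (m * suc s)
jetGraph {m} s G = record
  { Adj        = jetAdj s G
  ; Adj-sym    = jetAdj-sym s G
  ; Adj-irrefl = λ p → Adj-irrefl G (proj₁ p)
  }

-- A graph with a perfect matching u ↔ partner u satisfying Favaron's
-- property (P) -- every neighbour of u is adjacent to every neighbour of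
-- partner u -- is very well covered: a minimal vertex cover C contains an
-- end of each matching edge since the edge is covered, and not both ends,
-- since otherwise one of them could be removed from C.  So partner maps C
-- bijectively onto its complement.  K_{n,n} has such a matching (swap the
-- sides), and it passes to jet graphs: the partner of x_{i,j} is x_{i',s-j}
-- where i' is the partner of i.
module Submission where

open import Defs
open import Data.Nat using (ℕ; suc; _+_; _*_; _∸_; _≤_)
open import Data.Nat.Properties
  using (+-0-commutativeMonoid; +-identityʳ; m∸n+n≡m; m+[n∸m]≡n; +-cancelˡ-≤; +-monoˡ-≤; ≤-trans; ≤-pred; ≤-reflexive)
open import Data.Bool using (Bool; true; false)
open import Data.Fin using (Fin; toℕ; remQuot; combine; splitAt; join; opposite; _≟_)
open import Data.Fin.Properties
  using (splitAt-join; join-splitAt; remQuot-combine; combine-remQuot; opposite-prop; opposite-involutive; toℕ<n)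
open import Data.Fin.Subset using (Subset; _∈_; _∉_; _⊆_; _⊂_; ∣_∣; outside)
open import Data.Fin.Subset.Properties using (_∈?_)
open import Data.Fin.Permutation using (permutation)
open import Data.Vec using ([]; _∷_; lookup; _[_]≔_)
open import Data.Vec.Properties using ([]=⇒lookup; lookup⇒[]=; lookup∘update; lookup∘update′)
open import Data.Product using (_,_; proj₁; proj₂)
open import Data.Sum using (_⊎_; inj₁; inj₂; swap)
open import Data.Sum.Properties using (swap-involutive)
open import Data.Empty using (⊥-elim)
open import Data.Unit using (tt)
open import Relation.Nullary using (¬_; yes; no)
open import Relation.Binary.PropositionalEquality
  using (_≡_; _≢_; refl; sym; trans; cong; cong₂; subst; module ≡-Reasoning)
open import Function using (_∘_)
open import Algebra.Properties.CommutativeMonoid.Sum +-0-commutativeMonoid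
  using (sum; ∑-distrib-+; sum-permute; sum-cong-≗)

NeighboursIn : ∀ {m} → SimpleGraph m → Fin m → Subset m → Set
NeighboursIn G u C = ∀ w → Adj G u w → w ∈ C

module _ {m} {C : Subset m} {u : Fin m} where

  ∉-remove : u ∉ C [ u ]≔ outside
  ∉-remove u∈ with () ← trans (sym ([]=⇒lookup u∈)) (lookup∘update u C outside)

  ∈-remove⁺ : ∀ {x} → x ≢ u → x ∈ C → x ∈ C [ u ]≔ outside
  ∈-remove⁺ {x} x≢u x∈C = lookup⇒[]= x _ (trans (lookup∘update′ x≢u C outside) ([]=⇒lookup x∈C))

  remove-⊂ : u ∈ C → C [ u ]≔ outside ⊂ C
  remove-⊂ u∈C = remove-⊆ , u , u∈C , ∉-remove
    where
    remove-⊆ : C [ u ]≔ outside ⊆ C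
    remove-⊆ {x} x∈ with x ≟ u
    ... | yes refl = ⊥-elim (∉-remove x∈)
    ... | no x≢u   = lookup⇒[]= x C (trans (sym (lookup∘update′ x≢u C outside)) ([]=⇒lookup x∈))

module _ {m} (G : SimpleGraph m) {C : Subset m} where

  remove-isVertexCover : IsVertexCover G C → ∀ {u} → NeighboursIn G u C →
                         IsVertexCover G (C [ u ]≔ outside)
  remove-isVertexCover cover {u} nbrs x y xy with x ≟ u | y ≟ u
  ... | yes refl | yes refl = ⊥-elim (Adj-irrefl G xy)
  ... | yes refl | no y≢u   = inj₂ (∈-remove⁺ y≢u (nbrs y xy))
  ... | no x≢u   | yes refl = inj₁ (∈-remove⁺ x≢u (nbrs x (Adj-sym G xy)))
  ... | no x≢u   | no y≢u with cover x y xy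
  ...   | inj₁ x∈C = inj₁ (∈-remove⁺ x≢u x∈C)
  ...   | inj₂ y∈C = inj₂ (∈-remove⁺ y≢u y∈C)

  minimal⇒¬NeighboursIn : IsMinimalVertexCover G C → ∀ {u} → u ∈ C → ¬ NeighboursIn G u C
  minimal⇒¬NeighboursIn (cover , minimal) u∈C nbrs =
    minimal _ (remove-⊂ u∈C) (remove-isVertexCover cover nbrs)

indicator : Bool → ℕ
indicator true  = 1
indicator false = 0

∣p∣≡∑indicator : ∀ {m} (p : Subset m) → ∣ p ∣ ≡ sum (λ i → indicator (lookup p i))
∣p∣≡∑indicator []            = refl
∣p∣≡∑indicator (true  ∷ p) = cong suc (∣p∣≡∑indicator p)
∣p∣≡∑indicator (false ∷ p) = ∣p∣≡∑indicator p

∑1≡n : ∀ n → sum {n} (λ _ → 1) ≡ n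
∑1≡n 0       = refl
∑1≡n (suc n) = cong suc (∑1≡n n)

indicator-exactly-one : ∀ {m} {C : Subset m} {u v} → u ∈ C ⊎ v ∈ C → (u ∈ C → v ∉ C) →
                        indicator (lookup C u) + indicator (lookup C v) ≡ 1
indicator-exactly-one {C = C} {u} {v} one-of not-both with lookup C u in eu | lookup C v in ev
... | true  | true  = ⊥-elim (not-both (lookup⇒[]= u C eu) (lookup⇒[]= v C ev))
... | true  | false = refl
... | false | true  = refl
... | false | false with one-of
...   | inj₁ u∈C with () ← trans (sym eu) ([]=⇒lookup u∈C)
...   | inj₂ v∈C with () ← trans (sym ev) ([]=⇒lookup v∈C)

2*∣C∣≡m-by-involution : ∀ {m} (C : Subset m) (σ : Fin m → Fin m) → (∀ u → σ (σ u) ≡ u) →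
                        (∀ u → u ∈ C ⊎ σ u ∈ C) → (∀ u → u ∈ C → σ u ∉ C) → 2 * ∣ C ∣ ≡ m
2*∣C∣≡m-by-involution {m} C σ σσ one-of not-both = begin
  ∣ C ∣ + (∣ C ∣ + 0)        ≡⟨ cong (∣ C ∣ +_) (+-identityʳ ∣ C ∣) ⟩
  ∣ C ∣ + ∣ C ∣              ≡⟨ cong₂ _+_ (∣p∣≡∑indicator C) (∣p∣≡∑indicator C) ⟩
  sum f + sum f              ≡⟨ cong (sum f +_) (sum-permute f (permutation σ σ σσ σσ)) ⟩
  sum f + sum (λ i → f (σ i)) ≡⟨ ∑-distrib-+ f (λ i → f (σ i)) ⟨
  sum (λ i → f i + f (σ i))  ≡⟨ sum-cong-≗ (λ u → indicator-exactly-one (one-of u) (not-both u)) ⟩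
  sum {m} (λ _ → 1)          ≡⟨ ∑1≡n m ⟩
  m                          ∎
  where
  open ≡-Reasoning
  f : Fin m → ℕ
  f i = indicator (lookup C i)

record PropertyPMatching {m} (G : SimpleGraph m) : Set where
  field
    partner             : Fin m → Fin m
    partner-involutive  : ∀ u → partner (partner u) ≡ u
    adj-partner         : ∀ u → Adj G u (partner u)
    neighbours-adjacent : ∀ {u x w} → Adj G (partner u) x → Adj G u w → Adj G x w

module _ {m} {G : SimpleGraph m} (M : PropertyPMatching G) where
  open PropertyPMatching M

  minimal-cover-excludes-partner : ∀ {C} → IsMinimalVertexCover G C → ∀ {u} → u ∈ C → partner u ∉ C
  minimal-cover-excludes-partner {C} minimal {u} u∈C pu∈C =
    minimal⇒¬NeighboursIn G minimal u∈C nbrs-u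
    where
    nbrs-u : NeighboursIn G u C
    nbrs-u w uw with w ∈? C
    ... | yes w∈C = w∈C
    ... | no  w∉C = ⊥-elim (minimal⇒¬NeighboursIn G minimal pu∈C nbrs-pu)
      where
      nbrs-pu : NeighboursIn G (partner u) C
      nbrs-pu x pux with proj₁ minimal x w (neighbours-adjacent pux uw)
      ... | inj₁ x∈C = x∈C
      ... | inj₂ w∈C = ⊥-elim (w∉C w∈C)

  veryWellCovered : VeryWellCovered G
  veryWellCovered C minimal =
    2*∣C∣≡m-by-involution C partner partner-involutive
      (λ u → proj₁ minimal u (partner u) (adj-partner u))
      (λ u → minimal-cover-excludes-partner minimal)

≤-by-complement : ∀ {a b s} → a ≤ s → s ∸ a + b ≤ s → b ≤ a
≤-by-complement {a} {b} {s} a≤s h =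
  +-cancelˡ-≤ (s ∸ a) b a (subst (s ∸ a + b ≤_) (sym (m∸n+n≡m a≤s)) h)

module _ {m} {G : SimpleGraph m} (M : PropertyPMatching G) (s : ℕ) where
  open PropertyPMatching M

  private
    J : SimpleGraph (m * suc s)
    J = jetGraph s G

    level : Fin (m * suc s) → Fin (suc s)
    level u = proj₂ (remQuot {m} (suc s) u)

    jetPartner : Fin (m * suc s) → Fin (m * suc s)
    jetPartner u = combine (partner (vtx m s u)) (opposite (level u))

    remQuot-jetPartner : ∀ u → remQuot {m} (suc s) (jetPartner u) ≡ (partner (vtx m s u) , opposite (level u))
    remQuot-jetPartner u = remQuot-combine _ _

    vtx-jetPartner : ∀ u → vtx m s (jetPartner u) ≡ partner (vtx m s u)
    vtx-jetPartner u = cong proj₁ (remQuot-jetPartner u)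

    lvl≤s : ∀ u → lvl m s u ≤ s
    lvl≤s u = ≤-pred (toℕ<n (level u))

    lvl-jetPartner : ∀ u → lvl m s (jetPartner u) ≡ s ∸ lvl m s u
    lvl-jetPartner u = trans (cong (toℕ ∘ proj₂) (remQuot-jetPartner u)) (opposite-prop (level u))

    jetPartner-involutive : ∀ u → jetPartner (jetPartner u) ≡ u
    jetPartner-involutive u = begin
      combine (partner (vtx m s (jetPartner u))) (opposite (level (jetPartner u)))
        ≡⟨ cong₂ (λ i j → combine (partner i) (opposite j)) (vtx-jetPartner u) (cong proj₂ (remQuot-jetPartner u)) ⟩
      combine (partner (partner (vtx m s u))) (opposite (opposite (level u)))
        ≡⟨ cong₂ combine (partner-involutive (vtx m s u)) (opposite-involutive (level u)) ⟩
      combine (vtx m s u) (level u)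
        ≡⟨ combine-remQuot {m} (suc s) u ⟩
      u ∎
      where open ≡-Reasoning

    adj-jetPartner : ∀ u → Adj J u (jetPartner u)
    adj-jetPartner u =
      subst (Adj G (vtx m s u)) (sym (vtx-jetPartner u)) (adj-partner (vtx m s u)) ,
      subst (λ l → lvl m s u + l ≤ s) (sym (lvl-jetPartner u)) (≤-reflexive (m+[n∸m]≡n (lvl≤s u)))

    jet-neighbours-adjacent : ∀ {u x w} → Adj J (jetPartner u) x → Adj J u w → Adj J x w
    jet-neighbours-adjacent {u} {x} {w} (pux , pux-lvl) (uw , uw-lvl) =
      neighbours-adjacent (subst (λ i → Adj G i (vtx m s x)) (vtx-jetPartner u) pux) uw ,
      ≤-trans (+-monoˡ-≤ (lvl m s w) x≤u) uw-lvl
      where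
      x≤u : lvl m s x ≤ lvl m s u
      x≤u = ≤-by-complement (lvl≤s u) (subst (λ l → l + lvl m s x ≤ s) (lvl-jetPartner u) pux-lvl)

  jetPropertyPMatching : PropertyPMatching (jetGraph s G)
  jetPropertyPMatching = record
    { partner             = jetPartner
    ; partner-involutive  = jetPartner-involutive
    ; adj-partner         = adj-jetPartner
    ; neighbours-adjacent = jet-neighbours-adjacent
    }

KAdj-swap : ∀ {n} (a : Fin n ⊎ Fin n) → KAdj a (swap a)
KAdj-swap (inj₁ _) = tt
KAdj-swap (inj₂ _) = tt

KAdj-swap-neighbours : ∀ {n} (a c d : Fin n ⊎ Fin n) → KAdj (swap a) c → KAdj a d → KAdj c d
KAdj-swap-neighbours (inj₁ _) (inj₁ _) (inj₂ _) _ _ = tt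
KAdj-swap-neighbours (inj₂ _) (inj₂ _) (inj₁ _) _ _ = tt

completeBipartitePropertyPMatching : ∀ n → PropertyPMatching (completeBipartite n)
completeBipartitePropertyPMatching n = record
  { partner             = partner
  ; partner-involutive  = partner-involutive
  ; adj-partner         = λ u → subst (KAdj (splitAt n u)) (sym (splitAt-partner u)) (KAdj-swap (splitAt n u))
  ; neighbours-adjacent = λ {u} {x} {w} pux uw →
      KAdj-swap-neighbours (splitAt n u) (splitAt n x) (splitAt n w)
        (subst (λ a → KAdj a (splitAt n x)) (splitAt-partner u) pux) uw
  }
  where
  partner : Fin (n + n) → Fin (n + n)
  partner u = join n n (swap (splitAt n u))

  splitAt-partner : ∀ u → splitAt n (partner u) ≡ swap (splitAt n u)
  splitAt-partner u = splitAt-join n n (swap (splitAt n u))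

  partner-involutive : ∀ u → partner (partner u) ≡ u
  partner-involutive u = begin
    join n n (swap (splitAt n (partner u))) ≡⟨ cong (join n n ∘ swap) (splitAt-partner u) ⟩
    join n n (swap (swap (splitAt n u)))    ≡⟨ cong (join n n) (swap-involutive (splitAt n u)) ⟩
    join n n (splitAt n u)                  ≡⟨ join-splitAt n n u ⟩
    u                                       ∎
    where open ≡-Reasoning

theorem4 : (n s : ℕ) → VeryWellCovered (jetGraph s (completeBipartite (suc n)))
theorem4 n s = veryWellCovered (jetPropertyPMatching (completeBipartitePropertyPMatching (suc n)) s)
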